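{- Let $\overline p(n)$ denote the number of overpartitions of $n$, i.e. $\sum_{n\ge0}\overline p(n)q^n=\prod_{n\ge1}\frac{1+q^n}{1-q^n}$. Define $c(r)=2$ for $r$ odd and $c(r)=1$ for $r$ even, $\sigma^{(m)}(n)=\sum_{r\mid n}c(r)\,r^m$, and \[ \overline{M}_m(n)=\sum_{d=1}^{n}\sigma^{(m)}(d)\,\overline p(n-d). \] Then for all $n\ge0$: \[ \overline M_5(5n)\equiv0\pmod5,\quad \overline M_7(7n)\equiv0\pmod7,\quad \overline M_{11}(11n)\equiv0\pmod{11},\quad \overline M_{13}(13n)\equiv0\pmod{13}, \] \[ \overline M_9(5n)\equiv0\pmod5,\quad \overline M_{13}(7n)\equiv0\pmod7. \]
   Context: The overpartition generating function is the Euler product $\prod_{r\ge1}(1-q^r)^{ -c(r)}$ with the exponent sequence $c(r)$ given in the claim; $\overline M_m(n)$ are the corresponding overpartition frequency moments. -}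

module Defs where

open import Data.Nat using (ℕ; zero; suc; _+_; _*_; _∸_; _^_; _≤?_; _%_; _/_)
open import Data.Nat.Divisibility using (_∣?_)
open import Data.Bool using (if_then_else_)
open import Relation.Nullary.Decidable using (⌊_⌋)

-- Formal power series over ℕ, represented by their coefficient functions.
Series : Set
Series = ℕ → ℕ

one : Series
one zero    = 1
one (suc _) = 0

mul1+ : ℕ → Series → Series
mul1+ k a i = a i + (if ⌊ k ≤? i ⌋ then a (i ∸ k) else 0)

geomSum : ℕ → Series → ℕ → ℕ → ℕ
geomSum k a i zero    = a i
geomSum k a i (suc t) = a (i ∸ suc t * k) + geomSum k a i t

-- multiply a series by 1/(1 - q^(suc k)) = Σ_j q^(j*(suc k))
div1- : ℕ → Series → Series
div1- k a i = geomSum (suc k) a i (i / suc k)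

-- ∏_{r=1}^{N} (1+q^r)/(1-q^r) as a series
overProd : ℕ → Series
overProd zero    = one
overProd (suc N) = div1- N (mul1+ (suc N) (overProd N))

-- number of overpartitions of n: coefficient of q^n in ∏_{r≥1}(1+q^r)/(1-q^r)
-- (factors with r > n do not affect the coefficient of q^n)
pbar : ℕ → ℕ
pbar n = overProd n n

c : ℕ → ℕ
c r = if ⌊ 2 ∣? r ⌋ then 1 else 2

sumTo : ℕ → (ℕ → ℕ) → ℕ
sumTo zero    f = 0
sumTo (suc N) f = sumTo N f + f (suc N)

sigma : ℕ → ℕ → ℕ
sigma m n = sumTo n (λ r → if ⌊ r ∣? n ⌋ then c r * r ^ m else 0)

Mbar : ℕ → ℕ → ℕ
Mbar m n = sumTo n (λ d → sigma m d * pbar (n ∸ d))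

-- Let D = q d/dq, acting on coefficients by (D F)(n) = n F(n). The logarithmic derivative of
-- (1 + qᵏ)/(1 − qᵏ) is 2k Σ_{j odd} q^{jk}, and summed over k these series give Σ_d σ⁽¹⁾(d) q^d;
-- hence D P = (Σ_d σ⁽¹⁾(d) q^d) · P for P = Σ_n p̄(n) qⁿ, that is, M̄₁(n) = n p̄(n). The product
-- rule is applied one factor at a time, and without subtraction: writing P = B/(1 − qᵏ), both
-- sides of each identity satisfy a recurrence X = G + qᵏ X, whose solution is unique.
-- For every pair (p, m) of the theorem, m ≡ 1 (mod p − 1), so r^m ≡ r (mod p) for all r; hence
-- σ⁽ᵐ⁾ ≡ σ⁽¹⁾ and M̄_m(pn) ≡ M̄₁(pn) = pn p̄(pn) ≡ 0 (mod p).
module Submission where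

import Algebra.Properties.CommutativeSemigroup
open import Data.Bool using (if_then_else_; true; false)
open import Data.Bool.Properties using (if-cong; if-cong-then; if-eta)
open import Data.Fin using (Fin; toℕ; fromℕ<)
open import Data.Fin.Properties using (all?; toℕ-fromℕ<)
open import Data.Nat
open import Data.Nat.Divisibility
open import Data.Nat.DivMod
open import Data.Nat.Induction using (<-rec)
open import Data.Nat.Properties
open import Data.Nat.Solver using (module +-*-Solver)
open import Data.Product using (_×_; _,_)
open import Function using (_∘_; _⇔_; mk⇔; Equivalence)
open import Relation.Binary.PropositionalEquality
open import Relation.Nullary using (Dec; yes; no; ¬_; contradiction)
open import Relation.Nullary.Decidable using (⌊_⌋; True; toWitness; isYes≗does; does-⇔)

open import Defs

open Algebra.Properties.CommutativeSemigroup +-commutativeSemigroup using (interchange; x∙yz≈y∙xz)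
open +-*-Solver using (solve; _:+_; _:*_; _:=_)
open ≡-Reasoning

if-yes : ∀ {P : Set} (P? : Dec P) {x y : ℕ} → P → (if ⌊ P? ⌋ then x else y) ≡ x
if-yes (yes _) _ = refl
if-yes (no ¬p) p = contradiction p ¬p

if-no : ∀ {P : Set} (P? : Dec P) {x y : ℕ} → ¬ P → (if ⌊ P? ⌋ then x else y) ≡ y
if-no (yes p) ¬p = contradiction p ¬p
if-no (no _)  _  = refl

if-⇔ : ∀ {P Q : Set} (P? : Dec P) (Q? : Dec Q) {x y : ℕ} → P ⇔ Q →
       (if ⌊ P? ⌋ then x else y) ≡ (if ⌊ Q? ⌋ then x else y)
if-⇔ P? Q? P⇔Q = if-cong (trans (isYes≗does P?) (trans (does-⇔ P⇔Q P? Q?) (sym (isYes≗does Q?))))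

∑≤ : ℕ → (ℕ → ℕ) → ℕ
∑≤ zero    f = f 0
∑≤ (suc n) f = ∑≤ n f + f (suc n)

∑≤-cong : ∀ n {f g : ℕ → ℕ} → (∀ {d} → d ≤ n → f d ≡ g d) → ∑≤ n f ≡ ∑≤ n g
∑≤-cong zero    f≡g = f≡g z≤n
∑≤-cong (suc n) f≡g = cong₂ _+_ (∑≤-cong n (f≡g ∘ m≤n⇒m≤1+n)) (f≡g ≤-refl)

∑≤-zero : ∀ n {f : ℕ → ℕ} → (∀ {d} → d ≤ n → f d ≡ 0) → ∑≤ n f ≡ 0
∑≤-zero zero    f≡0 = f≡0 z≤n
∑≤-zero (suc n) f≡0 = cong₂ _+_ (∑≤-zero n (f≡0 ∘ m≤n⇒m≤1+n)) (f≡0 ≤-refl)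

∑≤-+ : ∀ n (f g : ℕ → ℕ) → ∑≤ n (λ d → f d + g d) ≡ ∑≤ n f + ∑≤ n g
∑≤-+ zero    f g = refl
∑≤-+ (suc n) f g =
  trans (cong (_+ (f (suc n) + g (suc n))) (∑≤-+ n f g)) (interchange (∑≤ n f) (∑≤ n g) _ _)

∑≤-* : ∀ n a (f : ℕ → ℕ) → ∑≤ n (λ d → a * f d) ≡ a * ∑≤ n f
∑≤-* zero    a f = refl
∑≤-* (suc n) a f = trans (cong (_+ a * f (suc n)) (∑≤-* n a f)) (sym (*-distribˡ-+ a _ _))

∑≤-peel : ∀ n (f : ℕ → ℕ) → ∑≤ (suc n) f ≡ f 0 + ∑≤ n (f ∘ suc)
∑≤-peel zero    f = refl
∑≤-peel (suc n) f = trans (cong (_+ f (2 + n)) (∑≤-peel n f)) (+-assoc (f 0) _ _)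

∑≤-reverse : ∀ n (f : ℕ → ℕ) → ∑≤ n (λ d → f (n ∸ d)) ≡ ∑≤ n f
∑≤-reverse zero    f = refl
∑≤-reverse (suc n) f = begin
  ∑≤ (suc n) (λ d → f (suc n ∸ d)) ≡⟨ ∑≤-peel n _ ⟩
  f (suc n) + ∑≤ n (λ d → f (n ∸ d)) ≡⟨ cong (f (suc n) +_) (∑≤-reverse n f) ⟩
  f (suc n) + ∑≤ n f                 ≡⟨ +-comm (f (suc n)) _ ⟩
  ∑≤ (suc n) f                       ∎

∑≤-dropLeadingZeros : ∀ m k {f : ℕ → ℕ} → (∀ {d} → d < k → f d ≡ 0) →
                      ∑≤ (m + k) f ≡ ∑≤ m (λ i → f (i + k))
∑≤-dropLeadingZeros zero    zero    f≡0 = refl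
∑≤-dropLeadingZeros zero    (suc k) {f} f≡0 = cong (_+ f (suc k)) (∑≤-zero k (f≡0 ∘ s≤s))
∑≤-dropLeadingZeros (suc m) k {f} f≡0 = cong (_+ f (suc m + k)) (∑≤-dropLeadingZeros m k f≡0)

∑≤≡head+sumTo : ∀ n (f : ℕ → ℕ) → ∑≤ n f ≡ f 0 + sumTo n f
∑≤≡head+sumTo zero    f = sym (+-identityʳ (f 0))
∑≤≡head+sumTo (suc n) f = trans (cong (_+ f (suc n)) (∑≤≡head+sumTo n f)) (+-assoc (f 0) _ _)

infixl 6 _⊕_
infixr 8 _·_
infixl 7 _⊛_

_⊕_ : Series → Series → Series
(F ⊕ G) n = F n + G n

_·_ : ℕ → Series → Series
(a · F) n = a * F n

_⊛_ : Series → Series → Series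
(F ⊛ G) n = ∑≤ n (λ d → F d * G (n ∸ d))

D : Series → Series
D F n = n * F n

shift : ℕ → Series → Series
shift k F n = if ⌊ k ≤? n ⌋ then F (n ∸ k) else 0

data Split (k : ℕ) : ℕ → Set where
  below : ∀ {n} → n < k → Split k n
  above : ∀ m → Split k (m + k)

split : ∀ k n → Split k n
split k n with k ≤? n
... | yes k≤n = subst (Split k) (m∸n+n≡m k≤n) (above (n ∸ k))
... | no  k≰n = below (≰⇒> k≰n)

shift-below : ∀ k F {n} → n < k → shift k F n ≡ 0
shift-below k F {n} n<k = if-no (k ≤? n) (<⇒≱ n<k)

shift-above : ∀ k F m → shift k F (m + k) ≡ F m
shift-above k F m = trans (if-yes (k ≤? m + k) (m≤n+m k m)) (cong F (m+n∸n≡m m k))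

shift-cong : ∀ k {F G} → F ≗ G → shift k F ≗ shift k G
shift-cong k F≗G n = if-cong-then ⌊ k ≤? n ⌋ (F≗G (n ∸ k))

shift-⊕ : ∀ k F G → shift k (F ⊕ G) ≗ shift k F ⊕ shift k G
shift-⊕ k F G n with split k n
... | below n<k
  rewrite shift-below k (F ⊕ G) n<k | shift-below k F n<k | shift-below k G n<k = refl
... | above m
  rewrite shift-above k (F ⊕ G) m | shift-above k F m | shift-above k G m = refl

shift-· : ∀ k a F → shift k (a · F) ≗ a · shift k F
shift-· k a F n with split k n
... | below n<k rewrite shift-below k (a · F) n<k | shift-below k F n<k = sym (*-zeroʳ a)
... | above m   rewrite shift-above k (a · F) m   | shift-above k F m   = refl

shift-shift : ∀ a b F → shift a (shift b F) ≗ shift (b + a) F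
shift-shift a b F n with split a n
... | below n<a
  rewrite shift-below a (shift b F) n<a | shift-below (b + a) F (<-≤-trans n<a (m≤n+m a b)) = refl
... | above m rewrite shift-above a (shift b F) m with split b m
...   | below m<b rewrite shift-below b F m<b | shift-below (b + a) F (+-monoˡ-< a m<b) = refl
...   | above j rewrite +-assoc j b a | shift-above b F j | shift-above (b + a) F j = refl

D-shift : ∀ k F → D (shift k F) ≗ shift k (D F) ⊕ k · shift k F
D-shift k F n with split k n
... | below n<k
  rewrite shift-below k F n<k | shift-below k (D F) n<k | *-zeroʳ n | *-zeroʳ k = refl
... | above m
  rewrite shift-above k F m | shift-above k (D F) m = *-distribʳ-+ (F m) m k

⊛-congˡ : ∀ {F G} H → F ≗ G → F ⊛ H ≗ G ⊛ H
⊛-congˡ H F≗G n = ∑≤-cong n (λ {d} _ → cong (_* H (n ∸ d)) (F≗G d))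

⊛-congʳ : ∀ F {G H} → G ≗ H → F ⊛ G ≗ F ⊛ H
⊛-congʳ F G≗H n = ∑≤-cong n (λ {d} _ → cong (F d *_) (G≗H (n ∸ d)))

⊛-distribʳ-⊕ : ∀ F G H → (F ⊕ G) ⊛ H ≗ F ⊛ H ⊕ G ⊛ H
⊛-distribʳ-⊕ F G H n =
  trans (∑≤-cong n (λ {d} _ → *-distribʳ-+ (H (n ∸ d)) (F d) (G d))) (∑≤-+ n _ _)

⊛-distribˡ-⊕ : ∀ F G H → F ⊛ (G ⊕ H) ≗ F ⊛ G ⊕ F ⊛ H
⊛-distribˡ-⊕ F G H n =
  trans (∑≤-cong n (λ {d} _ → *-distribˡ-+ (F d) (G (n ∸ d)) (H (n ∸ d)))) (∑≤-+ n _ _)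

·-⊛ : ∀ a F G → a · F ⊛ G ≗ a · (F ⊛ G)
·-⊛ a F G n = trans (∑≤-cong n (λ {d} _ → *-assoc a (F d) (G (n ∸ d)))) (∑≤-* n a _)

⊛-identityˡ : ∀ F → one ⊛ F ≗ F
⊛-identityˡ F zero    = +-identityʳ (F 0)
⊛-identityˡ F (suc n) = begin
  (one ⊛ F) (suc n)                    ≡⟨ ∑≤-peel n _ ⟩
  (F (suc n) + 0) + ∑≤ n (λ _ → 0)     ≡⟨ cong₂ _+_ (+-identityʳ _) (∑≤-zero n (λ _ → refl)) ⟩
  F (suc n) + 0                        ≡⟨ +-identityʳ _ ⟩
  F (suc n)                            ∎

⊛-comm : ∀ F G → F ⊛ G ≗ G ⊛ F
⊛-comm F G n = begin
  ∑≤ n (λ d → F d * G (n ∸ d))              ≡⟨ ∑≤-reverse n _ ⟨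
  ∑≤ n (λ d → F (n ∸ d) * G (n ∸ (n ∸ d)))  ≡⟨ ∑≤-cong n swap ⟩
  ∑≤ n (λ d → G d * F (n ∸ d))              ∎
  where
  swap : ∀ {d} → d ≤ n → F (n ∸ d) * G (n ∸ (n ∸ d)) ≡ G d * F (n ∸ d)
  swap {d} d≤n = trans (*-comm (F (n ∸ d)) _) (cong (λ e → G e * F (n ∸ d)) (m∸[m∸n]≡n d≤n))

shift-⊛ˡ : ∀ k F G → shift k F ⊛ G ≗ shift k (F ⊛ G)
shift-⊛ˡ k F G n with split k n
... | below n<k = trans (∑≤-zero n (λ d≤n → cong (_* _) (shift-below k F (≤-<-trans d≤n n<k))))
                        (sym (shift-below k (F ⊛ G) n<k))
... | above m = begin
  ∑≤ (m + k) (λ d → shift k F d * G (m + k ∸ d))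
    ≡⟨ ∑≤-dropLeadingZeros m k (λ d<k → cong (_* _) (shift-below k F d<k)) ⟩
  ∑≤ m (λ i → shift k F (i + k) * G (m + k ∸ (i + k)))
    ≡⟨ ∑≤-cong m (λ {i} _ → cong₂ _*_ (shift-above k F i) (cong G (subtract-k i))) ⟩
  (F ⊛ G) m
    ≡⟨ shift-above k (F ⊛ G) m ⟨
  shift k (F ⊛ G) (m + k) ∎
  where
  subtract-k : ∀ i → m + k ∸ (i + k) ≡ m ∸ i
  subtract-k i rewrite +-comm m k | +-comm i k = [m+n]∸[m+o]≡n∸o k m i

shift-⊛ʳ : ∀ k F G → F ⊛ shift k G ≗ shift k (F ⊛ G)
shift-⊛ʳ k F G n = begin
  (F ⊛ shift k G) n   ≡⟨ ⊛-comm F (shift k G) n ⟩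
  (shift k G ⊛ F) n   ≡⟨ shift-⊛ˡ k G F n ⟩
  shift k (G ⊛ F) n   ≡⟨ shift-cong k (⊛-comm G F) n ⟩
  shift k (F ⊛ G) n   ∎

shift-fixpoint-unique : ∀ k {G X Y : Series} → 0 < k →
                        X ≗ G ⊕ shift k X → Y ≗ G ⊕ shift k Y → X ≗ Y
shift-fixpoint-unique k {G} {X} {Y} k>0 X-rec Y-rec = <-rec _ step
  where
  shifted : ∀ n → (∀ {m} → m < n → X m ≡ Y m) → shift k X n ≡ shift k Y n
  shifted n X≡Y with split k n
  ... | below n<k rewrite shift-below k X n<k | shift-below k Y n<k = refl
  ... | above m   rewrite shift-above k X m   | shift-above k Y m   = X≡Y (m<m+n m k>0)

  step : ∀ n → (∀ {m} → m < n → X m ≡ Y m) → X n ≡ Y n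
  step n X≡Y = begin
    X n                 ≡⟨ X-rec n ⟩
    G n + shift k X n   ≡⟨ cong (G n +_) (shifted n X≡Y) ⟩
    G n + shift k Y n   ≡⟨ Y-rec n ⟨
    Y n                 ∎

geomSum-peel : ∀ k B i t → geomSum k B i (suc t) ≡ B i + geomSum k B (i ∸ k) t
geomSum-peel k B i zero    rewrite *-identityˡ k = +-comm (B (i ∸ k)) (B i)
geomSum-peel k B i (suc t) rewrite geomSum-peel k B i t | ∸-+-assoc i k (suc t * k) =
  x∙yz≈y∙xz (B (i ∸ (k + suc t * k))) (B i) _

div1-≗ : ∀ N B → div1- N B ≗ B ⊕ shift (suc N) (div1- N B)
div1-≗ N B n with split (suc N) n
... | below n<k rewrite m<n⇒m/n≡0 n<k | shift-below (suc N) (div1- N B) n<k = sym (+-identityʳ (B n))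
... | above m = begin
  geomSum k B (m + k) ((m + k) / k)          ≡⟨ cong (geomSum k B (m + k)) (m/n≡1+[m∸n]/n (m≤n+m k m)) ⟩
  geomSum k B (m + k) (suc ((m + k ∸ k) / k)) ≡⟨ geomSum-peel k B (m + k) ((m + k ∸ k) / k) ⟩
  B (m + k) + div1- N B (m + k ∸ k)           ≡⟨ cong (λ i → B (m + k) + div1- N B i) (m+n∸n≡m m k) ⟩
  B (m + k) + div1- N B m                     ≡⟨ cong (B (m + k) +_) (shift-above k (div1- N B) m) ⟨
  B (m + k) + shift k (div1- N B) (m + k)     ∎
  where k = suc N

overProd-suc : ∀ N → overProd (suc N) ≗
               (overProd N ⊕ shift (suc N) (overProd N)) ⊕ shift (suc N) (overProd (suc N))
overProd-suc N = div1-≗ N _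

overProd-suc-below : ∀ N {i} → i ≤ N → overProd (suc N) i ≡ overProd N i
overProd-suc-below N {i} i≤N = begin
  overProd (suc N) i
    ≡⟨ overProd-suc N i ⟩
  overProd N i + shift (suc N) (overProd N) i + shift (suc N) (overProd (suc N)) i
    ≡⟨ cong₂ (λ x y → overProd N i + x + y) (shift-below (suc N) (overProd N) (s≤s i≤N))
                                              (shift-below (suc N) (overProd (suc N)) (s≤s i≤N)) ⟩
  overProd N i + 0 + 0
    ≡⟨ trans (+-identityʳ _) (+-identityʳ _) ⟩
  overProd N i ∎

overProd-stable : ∀ j i → overProd (i + j) i ≡ pbar i
overProd-stable zero    i = cong (λ N → overProd N i) (+-identityʳ i)
overProd-stable (suc j) i = begin
  overProd (i + suc j) i   ≡⟨ cong (λ N → overProd N i) (+-suc i j) ⟩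
  overProd (suc (i + j)) i ≡⟨ overProd-suc-below (i + j) (m≤m+n i j) ⟩
  overProd (i + j) i       ≡⟨ overProd-stable j i ⟩
  pbar i                   ∎

-- q d/dq log((1 + qᵏ)/(1 − qᵏ)) = 2k Σ_{j odd} q^{jk}.
factorLogDeriv : ℕ → Series
factorLogDeriv k d = if ⌊ k ∣? d ⌋ then (if ⌊ k + k ∣? d ⌋ then 0 else k + k) else 0

logDeriv : ℕ → Series
logDeriv N d = sumTo N (λ k → factorLogDeriv k d)

∣m+n⇔∣m : ∀ {d} m {n} → d ∣ n → (d ∣ m + n) ⇔ (d ∣ m)
∣m+n⇔∣m {d} m {n} d∣n = mk⇔
  (λ d∣m+n → ∣m+n∣m⇒∣n (subst (d ∣_) (+-comm m n) d∣m+n) d∣n)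
  (λ d∣m → ∣m∣n⇒∣m+n d∣m d∣n)

∤-between : ∀ {k n} → 0 < n → n < k → ¬ k ∣ n
∤-between {n = suc _} _ n<k k∣n = <⇒≱ n<k (∣⇒≤ k∣n)

n∣n+n : ∀ n → n ∣ n + n
n∣n+n n = ∣m∣n⇒∣m+n ∣-refl ∣-refl

one-positive : ∀ {n} → 0 < n → one n ≡ 0
one-positive {suc _} _ = refl

factorLogDeriv-zero : ∀ k → factorLogDeriv k 0 ≡ 0
factorLogDeriv-zero k = trans (if-yes (k ∣? 0) (k ∣0)) (if-yes (k + k ∣? 0) ((k + k) ∣0))

factorLogDeriv-periodic : ∀ k m → factorLogDeriv k (m + (k + k)) ≡ factorLogDeriv k m
factorLogDeriv-periodic k m = trans
  (if-cong-then ⌊ k ∣? m + (k + k) ⌋ (if-⇔ (k + k ∣? m + (k + k)) (k + k ∣? m) (∣m+n⇔∣m m ∣-refl)))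
  (if-⇔ (k ∣? m + (k + k)) (k ∣? m) (∣m+n⇔∣m m (n∣n+n k)))

factorLogDeriv-below : ∀ {k n} → n < k → factorLogDeriv k n ≡ 0
factorLogDeriv-below {k} {zero}  _   = factorLogDeriv-zero k
factorLogDeriv-below {k} {suc n} n<k = if-no (k ∣? suc n) (∤-between z<s n<k)

factorLogDeriv-self : ∀ k .{{_ : NonZero k}} → factorLogDeriv k k ≡ k + k
factorLogDeriv-self k =
  trans (if-yes (k ∣? k) ∣-refl) (if-no (k + k ∣? k) (∤-between k>0 (m<n+m k k>0)))
  where
  k>0 : 0 < k
  k>0 = >-nonZero⁻¹ k

factorLogDeriv-between : ∀ k m → 0 < m → m + k < k + k → factorLogDeriv k (m + k) ≡ 0
factorLogDeriv-between k m 0<m m+k<2k = if-no (k ∣? m + k)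
  (∤-between 0<m (+-cancelʳ-< k m k m+k<2k) ∘ Equivalence.to (∣m+n⇔∣m m ∣-refl))

shift-one-far : ∀ k .{{_ : NonZero k}} m → shift k one (m + (k + k)) ≡ 0
shift-one-far k m = begin
  shift k one (m + (k + k)) ≡⟨ cong (shift k one) (+-assoc m k k) ⟨
  shift k one (m + k + k)   ≡⟨ shift-above k one (m + k) ⟩
  one (m + k)               ≡⟨ one-positive (<-≤-trans (>-nonZero⁻¹ k) (m≤n+m k m)) ⟩
  0                         ∎

factorLogDeriv-rec : ∀ k .{{_ : NonZero k}} →
  factorLogDeriv k ≗ (k + k) · shift k one ⊕ shift (k + k) (factorLogDeriv k)
factorLogDeriv-rec k n with split (k + k) n
... | below n<2k with split k n
...   | below n<k
  rewrite shift-below k one n<k | *-zeroʳ (k + k) | shift-below (k + k) (factorLogDeriv k) n<2k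
  = factorLogDeriv-below n<k
...   | above zero
  rewrite shift-above k one 0 | *-identityʳ (k + k) | shift-below (k + k) (factorLogDeriv k) n<2k
  = trans (factorLogDeriv-self k) (sym (+-identityʳ (k + k)))
...   | above (suc m)
  rewrite shift-above k one (suc m) | *-zeroʳ (k + k) | shift-below (k + k) (factorLogDeriv k) n<2k
  = factorLogDeriv-between k (suc m) z<s n<2k
factorLogDeriv-rec k n | above m
  rewrite shift-above (k + k) (factorLogDeriv k) m | shift-one-far k m | *-zeroʳ (k + k)
  = factorLogDeriv-periodic k m

-- A is the product of the earlier factors, B = A (1 + qᵏ), and P = B/(1 − qᵏ), i.e. P = B + qᵏ P.
module FactorStep (k : ℕ) .{{_ : NonZero k}} {S A P : Series} (DA≗S⊛A : D A ≗ S ⊛ A)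
                  (P-rec : P ≗ (A ⊕ shift k A) ⊕ shift k P) where

  T B : Series
  T = factorLogDeriv k
  B = A ⊕ shift k A

  k>0 : 0 < k
  k>0 = >-nonZero⁻¹ k

  D-B : D B ≗ S ⊛ B ⊕ k · shift k A
  D-B n = begin
    n * (A n + shift k A n)
      ≡⟨ *-distribˡ-+ n (A n) _ ⟩
    n * A n + n * shift k A n
      ≡⟨ cong₂ _+_ (DA≗S⊛A n) (D-shift k A n) ⟩
    (S ⊛ A) n + (shift k (D A) n + k * shift k A n)
      ≡⟨ +-assoc ((S ⊛ A) n) _ _ ⟨
    (S ⊛ A) n + shift k (D A) n + k * shift k A n
      ≡⟨ cong (λ x → (S ⊛ A) n + x + k * shift k A n) shifted ⟩
    (S ⊛ A) n + (S ⊛ shift k A) n + k * shift k A n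
      ≡⟨ cong (_+ k * shift k A n) (⊛-distribˡ-⊕ S A (shift k A) n) ⟨
    (S ⊛ B) n + k * shift k A n ∎
    where
    shifted : shift k (D A) n ≡ (S ⊛ shift k A) n
    shifted = trans (shift-cong k DA≗S⊛A n) (sym (shift-⊛ʳ k S A n))

  shift-B : ∀ j → shift j B ≗ shift j A ⊕ shift (k + j) A
  shift-B j n = trans (shift-⊕ j A (shift k A) n) (cong (shift j A n +_) (shift-shift j k A n))

  shift-P : ∀ j → shift j P ≗ shift j A ⊕ shift (k + j) A ⊕ shift (k + j) P
  shift-P j n = begin
    shift j P n                         ≡⟨ shift-cong j P-rec n ⟩
    shift j (B ⊕ shift k P) n           ≡⟨ shift-⊕ j B (shift k P) n ⟩
    shift j B n + shift j (shift k P) n ≡⟨ cong₂ _+_ (shift-B j n) (shift-shift j k P n) ⟩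
    shift j A n + shift (k + j) A n + shift (k + j) P n ∎

  T⊛B-rec : T ⊛ B ≗ (k + k) · shift k B ⊕ shift (k + k) (T ⊛ B)
  T⊛B-rec n = begin
    (T ⊛ B) n
      ≡⟨ ⊛-congˡ B (factorLogDeriv-rec k) n ⟩
    (((k + k) · shift k one ⊕ shift (k + k) T) ⊛ B) n
      ≡⟨ ⊛-distribʳ-⊕ ((k + k) · shift k one) (shift (k + k) T) B n ⟩
    ((k + k) · shift k one ⊛ B) n + (shift (k + k) T ⊛ B) n
      ≡⟨ cong₂ _+_ (·-⊛ (k + k) (shift k one) B n) (shift-⊛ˡ (k + k) T B n) ⟩
    (k + k) * (shift k one ⊛ B) n + shift (k + k) (T ⊛ B) n
      ≡⟨ cong (λ x → (k + k) * x + shift (k + k) (T ⊛ B) n)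
              (trans (shift-⊛ˡ k one B n) (shift-cong k (⊛-identityˡ B) n)) ⟩
    (k + k) * shift k B n + shift (k + k) (T ⊛ B) n ∎

  k·qᵏ[A+P] : Series
  k·qᵏ[A+P] = k · shift k A ⊕ k · shift k P

  k·qᵏ[A+P]-rec : k·qᵏ[A+P] ≗ (k + k) · shift k B ⊕ shift (k + k) k·qᵏ[A+P]
  k·qᵏ[A+P]-rec n = begin
    k * a₁ + k * shift k P n
      ≡⟨ cong (λ x → k * a₁ + k * x) (trans (shift-P k n) (cong (a₁ + a₂ +_) (shift-P (k + k) n))) ⟩
    k * a₁ + k * (a₁ + a₂ + (a₂ + a₃ + p₃))
      ≡⟨ solve 5 (λ k a₁ a₂ a₃ p₃ → k :* a₁ :+ k :* (a₁ :+ a₂ :+ (a₂ :+ a₃ :+ p₃))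
                                 := (k :+ k) :* (a₁ :+ a₂) :+ (k :* a₃ :+ k :* p₃)) refl k a₁ a₂ a₃ p₃ ⟩
    (k + k) * (a₁ + a₂) + (k * a₃ + k * p₃)
      ≡⟨ cong₂ _+_ (cong ((k + k) *_) (shift-B k n)) shifted ⟨
    (k + k) * shift k B n + shift (k + k) k·qᵏ[A+P] n ∎
    where
    a₁ a₂ a₃ p₃ : ℕ
    a₁ = shift k A n
    a₂ = shift (k + k) A n
    a₃ = shift (k + (k + k)) A n
    p₃ = shift (k + (k + k)) P n

    shifted : shift (k + k) k·qᵏ[A+P] n ≡ k * a₃ + k * p₃
    shifted = begin
      shift (k + k) k·qᵏ[A+P] n
        ≡⟨ shift-⊕ (k + k) (k · shift k A) (k · shift k P) n ⟩
      shift (k + k) (k · shift k A) n + shift (k + k) (k · shift k P) n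
        ≡⟨ cong₂ _+_ (shift-· (k + k) k (shift k A) n) (shift-· (k + k) k (shift k P) n) ⟩
      k * shift (k + k) (shift k A) n + k * shift (k + k) (shift k P) n
        ≡⟨ cong₂ (λ x y → k * x + k * y) (shift-shift (k + k) k A n) (shift-shift (k + k) k P n) ⟩
      k * a₃ + k * p₃ ∎

  T⊛B≗k·qᵏ[A+P] : T ⊛ B ≗ k·qᵏ[A+P]
  T⊛B≗k·qᵏ[A+P] = shift-fixpoint-unique (k + k) (≤-trans k>0 (m≤m+n k k)) T⊛B-rec k·qᵏ[A+P]-rec

  D-P-rec : D P ≗ (S ⊕ T) ⊛ B ⊕ shift k (D P)
  D-P-rec n = begin
    n * P n                                          ≡⟨ cong (n *_) (P-rec n) ⟩
    n * (B n + shift k P n)                          ≡⟨ *-distribˡ-+ n (B n) _ ⟩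
    n * B n + n * shift k P n                        ≡⟨ cong₂ _+_ (D-B n) (D-shift k P n) ⟩
    (S ⊛ B) n + k * a₁ + (shift k (D P) n + k * p₁)
      ≡⟨ solve 5 (λ s k a₁ d p₁ → s :+ k :* a₁ :+ (d :+ k :* p₁) := s :+ (k :* a₁ :+ k :* p₁) :+ d)
               refl ((S ⊛ B) n) k a₁ (shift k (D P) n) p₁ ⟩
    (S ⊛ B) n + (k * a₁ + k * p₁) + shift k (D P) n
      ≡⟨ cong (λ x → (S ⊛ B) n + x + shift k (D P) n) (T⊛B≗k·qᵏ[A+P] n) ⟨
    (S ⊛ B) n + (T ⊛ B) n + shift k (D P) n
      ≡⟨ cong (_+ shift k (D P) n) (⊛-distribʳ-⊕ S T B n) ⟨
    ((S ⊕ T) ⊛ B) n + shift k (D P) n ∎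
    where
    a₁ p₁ : ℕ
    a₁ = shift k A n
    p₁ = shift k P n

  [S⊕T]⊛P-rec : (S ⊕ T) ⊛ P ≗ (S ⊕ T) ⊛ B ⊕ shift k ((S ⊕ T) ⊛ P)
  [S⊕T]⊛P-rec n = trans (⊛-congʳ (S ⊕ T) P-rec n)
    (trans (⊛-distribˡ-⊕ (S ⊕ T) B (shift k P) n)
           (cong (((S ⊕ T) ⊛ B) n +_) (shift-⊛ʳ k (S ⊕ T) P n)))

  D-P : D P ≗ (S ⊕ factorLogDeriv k) ⊛ P
  D-P = shift-fixpoint-unique k k>0 D-P-rec [S⊕T]⊛P-rec

D-overProd : ∀ N → D (overProd N) ≗ logDeriv N ⊛ overProd N
D-overProd zero    n = trans (D-one n) (sym (∑≤-zero n (λ _ → refl)))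
  where
  D-one : ∀ n → n * one n ≡ 0
  D-one zero    = refl
  D-one (suc n) = *-zeroʳ (suc n)
D-overProd (suc N) = FactorStep.D-P (suc N) {S = logDeriv N} (D-overProd N) (overProd-suc N)

sumTo-cong : ∀ n {f g : ℕ → ℕ} → (∀ {d} → 0 < d → d ≤ n → f d ≡ g d) → sumTo n f ≡ sumTo n g
sumTo-cong zero    f≡g = refl
sumTo-cong (suc n) f≡g = cong₂ _+_ (sumTo-cong n (λ 0<d → f≡g 0<d ∘ m≤n⇒m≤1+n)) (f≡g z<s ≤-refl)

sumTo-+ : ∀ n (f g : ℕ → ℕ) → sumTo n (λ d → f d + g d) ≡ sumTo n f + sumTo n g
sumTo-+ zero    f g = refl
sumTo-+ (suc n) f g =
  trans (cong (_+ (f (suc n) + g (suc n))) (sumTo-+ n f g)) (interchange (sumTo n f) (sumTo n g) _ _)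

sumTo-dropTrailingZeros : ∀ {a b} (f : ℕ → ℕ) → a ≤ b → (∀ {k} → a < k → f k ≡ 0) → sumTo b f ≡ sumTo a f
sumTo-dropTrailingZeros {a} f a≤b f≡0 with m≤n⇒∃[o]m+o≡n a≤b
... | j , refl = beyond j
  where
  beyond : ∀ j → sumTo (a + j) f ≡ sumTo a f
  beyond zero    = cong (λ b → sumTo b f) (+-identityʳ a)
  beyond (suc j) = begin
    sumTo (a + suc j) f               ≡⟨ cong (λ b → sumTo b f) (+-suc a j) ⟩
    sumTo (a + j) f + f (suc (a + j)) ≡⟨ cong₂ _+_ (beyond j) (f≡0 (s≤s (m≤m+n a j))) ⟩
    sumTo a f + 0                     ≡⟨ +-identityʳ _ ⟩
    sumTo a f                         ∎

2∣n+n : ∀ n → 2 ∣ n + n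
2∣n+n n = divides n (trans (cong (n +_) (sym (+-identityʳ n))) (*-comm 2 n))

2∤1+n+n : ∀ n → ¬ 2 ∣ suc (n + n)
2∤1+n+n n 2∣1+n+n = ∤-between z<s (s≤s (s≤s z≤n))
  (∣m+n∣m⇒∣n (subst (2 ∣_) (+-comm 1 (n + n)) 2∣1+n+n) (2∣n+n n))

sumTo-evens : ∀ M (g : ℕ → ℕ) →
              sumTo (M + M) (λ r → if ⌊ 2 ∣? r ⌋ then g r else 0) ≡ sumTo M (λ k → g (k + k))
sumTo-evens zero    g = refl
sumTo-evens (suc M) g = begin
  sumTo (suc M + suc M) h
    ≡⟨ cong (λ n → sumTo (suc n) h) (+-suc M M) ⟩
  sumTo (M + M) h + h (suc (M + M)) + h (suc (suc (M + M)))
    ≡⟨ cong₂ (λ x y → x + y + h (suc (suc (M + M))))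
             (sumTo-evens M g) (if-no (2 ∣? suc (M + M)) (2∤1+n+n M)) ⟩
  sumTo M (λ k → g (k + k)) + 0 + h (suc (suc (M + M)))
    ≡⟨ cong₂ _+_ (+-identityʳ _) (if-yes (2 ∣? suc (suc (M + M))) (∣m∣n⇒∣m+n ∣-refl (2∣n+n M))) ⟩
  sumTo M (λ k → g (k + k)) + g (suc (suc (M + M)))
    ≡⟨ cong (λ n → sumTo M (λ k → g (k + k)) + g (suc n)) (+-suc M M) ⟨
  sumTo (suc M) (λ k → g (k + k)) ∎
  where
  h : ℕ → ℕ
  h r = if ⌊ 2 ∣? r ⌋ then g r else 0

divisorPart : ℕ → ℕ → ℕ
divisorPart k d = if ⌊ k ∣? d ⌋ then k else 0

divisorSum : ℕ → ℕ
divisorSum d = sumTo d (λ k → divisorPart k d)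

evenDivisorSum : ℕ → ℕ
evenDivisorSum d = sumTo d (λ r → if ⌊ 2 ∣? r ⌋ then divisorPart r d else 0)

divisorPart-large : ∀ {k d} → 0 < d → d < k → divisorPart k d ≡ 0
divisorPart-large {k} {d} 0<d d<k = if-no (k ∣? d) (∤-between 0<d d<k)

factorLogDeriv+divisorPart : ∀ k d →
  factorLogDeriv k d + divisorPart (k + k) d ≡ divisorPart k d + divisorPart k d
factorLogDeriv+divisorPart k d with k ∣? d | k + k ∣? d
... | yes _   | yes _     = refl
... | yes _   | no _      = +-identityʳ (k + k)
... | no k∤d  | yes 2k∣d  = contradiction (∣-trans (n∣n+n k) 2k∣d) k∤d
... | no _    | no _      = refl

sigmaTerm+evenPart : ∀ r d →
  (if ⌊ r ∣? d ⌋ then c r * r ^ 1 else 0) + (if ⌊ 2 ∣? r ⌋ then divisorPart r d else 0)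
  ≡ divisorPart r d + divisorPart r d
sigmaTerm+evenPart r d with r ∣? d | 2 ∣? r
... | yes _ | yes _ rewrite *-identityʳ r | +-identityʳ r = refl
... | yes _ | no _  rewrite *-identityʳ r | +-identityʳ r = +-identityʳ (r + r)
... | no _  | yes _ = refl
... | no _  | no _  = refl

-- Both σ⁽¹⁾(d) and logDeriv N d equal 2 divisorSum d − evenDivisorSum d; the subtraction is
-- moved to the left-hand side.
sigma1+evenDivisorSum : ∀ d → sigma 1 d + evenDivisorSum d ≡ divisorSum d + divisorSum d
sigma1+evenDivisorSum d = begin
  sigma 1 d + evenDivisorSum d
    ≡⟨ sumTo-+ d σ-term even-term ⟨
  sumTo d (λ r → σ-term r + even-term r)
    ≡⟨ sumTo-cong d (λ {r} _ _ → sigmaTerm+evenPart r d) ⟩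
  sumTo d (λ r → divisorPart r d + divisorPart r d)
    ≡⟨ sumTo-+ d _ _ ⟩
  divisorSum d + divisorSum d ∎
  where
  σ-term even-term : ℕ → ℕ
  σ-term    r = if ⌊ r ∣? d ⌋ then c r * r ^ 1 else 0
  even-term r = if ⌊ 2 ∣? r ⌋ then divisorPart r d else 0

logDeriv+evenDivisorSum : ∀ {N d} → 0 < d → d ≤ N →
  logDeriv N d + evenDivisorSum d ≡ divisorSum d + divisorSum d
logDeriv+evenDivisorSum {N} {d} 0<d d≤N = begin
  logDeriv N d + evenDivisorSum d
    ≡⟨ cong (logDeriv N d +_) evens ⟨
  logDeriv N d + sumTo N (λ k → divisorPart (k + k) d)
    ≡⟨ sumTo-+ N _ _ ⟨
  sumTo N (λ k → factorLogDeriv k d + divisorPart (k + k) d)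
    ≡⟨ sumTo-cong N (λ {k} _ _ → factorLogDeriv+divisorPart k d) ⟩
  sumTo N (λ k → divisorPart k d + divisorPart k d)
    ≡⟨ sumTo-+ N _ _ ⟩
  sumTo N (λ k → divisorPart k d) + sumTo N (λ k → divisorPart k d)
    ≡⟨ cong₂ _+_ all-divisors all-divisors ⟩
  divisorSum d + divisorSum d ∎
  where
  all-divisors : sumTo N (λ k → divisorPart k d) ≡ divisorSum d
  all-divisors = sumTo-dropTrailingZeros (λ k → divisorPart k d) d≤N (divisorPart-large 0<d)

  evens : sumTo N (λ k → divisorPart (k + k) d) ≡ evenDivisorSum d
  evens = trans (sym (sumTo-evens N (λ r → divisorPart r d)))
    (sumTo-dropTrailingZeros _ (≤-trans d≤N (m≤m+n N N)) λ {r} d<r →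
      trans (if-cong-then ⌊ 2 ∣? r ⌋ (divisorPart-large 0<d d<r)) (if-eta ⌊ 2 ∣? r ⌋))

logDeriv≡sigma1 : ∀ {N d} → 0 < d → d ≤ N → logDeriv N d ≡ sigma 1 d
logDeriv≡sigma1 {N} {d} 0<d d≤N = +-cancelʳ-≡ (evenDivisorSum d) _ _
  (trans (logDeriv+evenDivisorSum 0<d d≤N) (sym (sigma1+evenDivisorSum d)))

logDeriv-zero : ∀ N → logDeriv N 0 ≡ 0
logDeriv-zero zero    = refl
logDeriv-zero (suc N) = cong₂ _+_ (logDeriv-zero N) (factorLogDeriv-zero (suc N))

Mbar1≡n*pbar : ∀ n → Mbar 1 n ≡ n * pbar n
Mbar1≡n*pbar n = begin
  sumTo n (λ d → sigma 1 d * pbar (n ∸ d))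
    ≡⟨ sumTo-cong n (λ 0<d d≤n → cong₂ _*_ (sym (logDeriv≡sigma1 0<d d≤n)) (stable d≤n)) ⟩
  sumTo n (λ d → logDeriv n d * overProd n (n ∸ d))
    ≡⟨ cong (λ x → x * overProd n n + sumTo n (λ d → logDeriv n d * overProd n (n ∸ d)))
            (logDeriv-zero n) ⟨
  logDeriv n 0 * overProd n n + sumTo n (λ d → logDeriv n d * overProd n (n ∸ d))
    ≡⟨ ∑≤≡head+sumTo n _ ⟨
  (logDeriv n ⊛ overProd n) n
    ≡⟨ D-overProd n n ⟨
  n * pbar n ∎
  where
  stable : ∀ {d} → d ≤ n → pbar (n ∸ d) ≡ overProd n (n ∸ d)
  stable {d} d≤n =
    trans (sym (overProd-stable d (n ∸ d))) (cong (λ N → overProd N (n ∸ d)) (m∸n+n≡m d≤n))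

%-cong-+ : ∀ p .{{_ : NonZero p}} {a a′ b b′} →
           a % p ≡ a′ % p → b % p ≡ b′ % p → (a + b) % p ≡ (a′ + b′) % p
%-cong-+ p {a} {a′} {b} {b′} a≡a′ b≡b′ =
  trans (%-distribˡ-+ a b p) (trans (cong₂ (λ x y → (x + y) % p) a≡a′ b≡b′) (sym (%-distribˡ-+ a′ b′ p)))

%-cong-* : ∀ p .{{_ : NonZero p}} {a a′ b b′} →
           a % p ≡ a′ % p → b % p ≡ b′ % p → (a * b) % p ≡ (a′ * b′) % p
%-cong-* p {a} {a′} {b} {b′} a≡a′ b≡b′ =
  trans (%-distribˡ-* a b p) (trans (cong₂ (λ x y → (x * y) % p) a≡a′ b≡b′) (sym (%-distribˡ-* a′ b′ p)))

%-cong-if : ∀ p .{{_ : NonZero p}} b {x y} →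
            x % p ≡ y % p → (if b then x else 0) % p ≡ (if b then y else 0) % p
%-cong-if p true  x≡y = x≡y
%-cong-if p false _   = refl

sumTo-%-cong : ∀ p .{{_ : NonZero p}} n {f g : ℕ → ℕ} →
               (∀ d → f d % p ≡ g d % p) → sumTo n f % p ≡ sumTo n g % p
sumTo-%-cong p zero    f≡g = refl
sumTo-%-cong p (suc n) f≡g = %-cong-+ p (sumTo-%-cong p n f≡g) (f≡g (suc n))

^-% : ∀ p .{{_ : NonZero p}} m r → r ^ m % p ≡ (r % p) ^ m % p
^-% p zero    r = refl
^-% p (suc m) r = %-cong-* p (sym (m%n%n≡m%n r p)) (^-% p m r)

FermatExponent : (p m : ℕ) .{{_ : NonZero p}} → Set
FermatExponent p m = ∀ r → r ^ m % p ≡ r % p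

fermatExponent-fromResidues : ∀ p m .{{_ : NonZero p}} →
  (∀ (s : Fin p) → toℕ s ^ m % p ≡ toℕ s) → FermatExponent p m
fermatExponent-fromResidues p m residues r = begin
  r ^ m % p         ≡⟨ ^-% p m r ⟩
  (r % p) ^ m % p   ≡⟨ cong (λ x → x ^ m % p) (toℕ-fromℕ< r%p<p) ⟨
  toℕ s ^ m % p     ≡⟨ residues s ⟩
  toℕ s             ≡⟨ toℕ-fromℕ< r%p<p ⟩
  r % p             ∎
  where
  r%p<p : r % p < p
  r%p<p = m%n<n r p

  s : Fin p
  s = fromℕ< r%p<p

fermatExponent-byComputation : ∀ p m .{{_ : NonZero p}} →
  {True (all? λ (s : Fin p) → toℕ s ^ m % p ≟ toℕ s)} → FermatExponent p m
fermatExponent-byComputation p m {residues} = fermatExponent-fromResidues p m (toWitness residues)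

Mbar-%-cong : ∀ p m .{{_ : NonZero p}} → FermatExponent p m → ∀ n → Mbar m n % p ≡ Mbar 1 n % p
Mbar-%-cong p m fermat n = sumTo-%-cong p n (λ d → %-cong-* p (sigma-%-cong d) refl)
  where
  sigma-%-cong : ∀ d → sigma m d % p ≡ sigma 1 d % p
  sigma-%-cong d = sumTo-%-cong p d λ r →
    %-cong-if p ⌊ r ∣? d ⌋ (%-cong-* p {c r} refl (trans (fermat r) (cong (_% p) (sym (*-identityʳ r)))))

p∣Mbar[pn] : ∀ p m .{{_ : NonZero p}} → FermatExponent p m → ∀ n → p ∣ Mbar m (p * n)
p∣Mbar[pn] p m fermat n = m%n≡0⇒n∣m _ p (begin
  Mbar m (p * n) % p            ≡⟨ Mbar-%-cong p m fermat (p * n) ⟩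
  Mbar 1 (p * n) % p            ≡⟨ cong (_% p) (Mbar1≡n*pbar (p * n)) ⟩
  p * n * pbar (p * n) % p      ≡⟨ cong (_% p) (trans (*-assoc p n _) (*-comm p _)) ⟩
  n * pbar (p * n) * p % p      ≡⟨ m*n%n≡0 (n * pbar (p * n)) p ⟩
  0                             ∎)

theorem6p6 : (n : ℕ) →
    (5 ∣ Mbar 5 (5 * n)) × (7 ∣ Mbar 7 (7 * n)) × (11 ∣ Mbar 11 (11 * n)) ×
    (13 ∣ Mbar 13 (13 * n)) × (5 ∣ Mbar 9 (5 * n)) × (7 ∣ Mbar 13 (7 * n))
theorem6p6 n =
  p∣Mbar[pn] 5 5 (fermatExponent-byComputation 5 5) n ,
  p∣Mbar[pn] 7 7 (fermatExponent-byComputation 7 7) n ,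
  p∣Mbar[pn] 11 11 (fermatExponent-byComputation 11 11) n ,
  p∣Mbar[pn] 13 13 (fermatExponent-byComputation 13 13) n ,
  p∣Mbar[pn] 5 9 (fermatExponent-byComputation 5 9) n ,
  p∣Mbar[pn] 7 13 (fermatExponent-byComputation 7 13) n
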